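{- Let $G=(V,E,\ell)$ be a weighted graph, $\Phi=(I,T,\mathcal{C})$ an interface of $G$, $F$ a $\Phi$-tour in $G$, and $W\subseteq V$. Let $\Phi_W$ be the interface induced by $(F,\Phi)$ on $W$. Then (1) $\Phi_W$ is an interface of $G[W]$; (2) $F[W]$ is a $\Phi_W$-tour in $G[W]$; and (3) for every $W'\subseteq W$, the interface induced by $(F[W],\Phi_W)$ on $W'$ equals the interface induced by $(F,\Phi)$ on $W'$.
   Context: A weighted graph $G=(V,E,\ell)$ is an undirected graph without loops or parallel edges with $\ell:E\to\mathbb{R}_{\ge0}$. Multi-sets of edges are allowed (written $F\subseteq E$); $\mathrm{odd}(F)$ is the set of odd-degree vertices; $F[W]$ is the multi-set of edges of $F$ with both endpoints in $W$, and $G[W]$ the induced subgraph. $G/I$ is $G$ with $I$ contracted ($G/\emptyset=G$). An interface of a graph $H=(U,E_H)$ is $\Phi=(I,T,\mathcal{C})$ with $T\subseteq I\subseteq U$, $|T|$ even, $\mathcal{C}$ a partition of $I$. A $\Phi$-tour in $H$ is a multi-set $F\subseteq E_H$ with $\mathrm{odd}(F)=T$, $(U,F)/I$ connected, each $C\in\mathcal{C}$ inside one connected component of $(U,F)$. Induced interface: for an interface $\Phi=(I,T,\mathcal{C})$ of $G$, a $\Phi$-tour $F$ in $G$ and $W\subseteq V$, the interface induced by $(F,\Phi)$ on $W$ is $\Phi_W=(I_W,T_W,\mathcal{C}_W)$ where $I_W=(I\cap W)\cup U$ with $U$ the set of vertices in $W$ joined by an edge of $F$ to a vertex of $V\setminus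 W$; $T_W=\mathrm{odd}(F[W])$; and $\mathcal{C}_W$ contains, for each connected component of $(W,F[W])$, the set of vertices of $I_W$ in that component (nonempty sets only). In (3), the interface induced by $(F[W],\Phi_W)$ on $W'$ is defined by the same rule within the graph $G[W]$.
   Formalization: The edge lengths ℓ of G take values in the non-negative rationals instead of the non-negative reals. -}

module Defs where

open import Level using (0ℓ)
open import Data.Nat using (ℕ; zero; suc; _+_)
open import Data.Nat.Divisibility using (_∣_)
open import Data.Bool using (Bool; true; false; _∧_; _∨_; not; if_then_else_)
open import Data.Bool.Properties using (∧-comm)
open import Data.Fin using (Fin; _≟_) renaming (zero to fzero; suc to fsuc)
open import Data.Vec using (here; there)
open import Data.Fin.Subset using (Subset; _∈_; _⊆_; _∩_; _∪_; ∣_∣; Nonempty; Empty)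
open import Data.Vec using (Vec; lookup; tabulate)
open import Data.List using (List; []; _∷_; filter)
open import Data.Bool.ListAction using (any)
open import Data.List.Membership.Propositional using () renaming (_∈_ to _∈ₗ_)
open import Data.List.Relation.Unary.All using (All)
open import Data.Product using (Σ; ∃; _×_; _,_; proj₁; proj₂)
open import Data.Sum using (_⊎_)
open import Data.Rational using (ℚ; 0ℚ) renaming (_≤_ to _≤ℚ_)
open import Relation.Nullary using (⌊_⌋; does)
open import Relation.Binary.PropositionalEquality using (_≡_; refl; cong; trans)

-- Vertices of every graph are drawn from a fixed finite ambient set Fin n;
-- a graph H = (U , E_H) has vertex set U ⊆ Fin n.

_∈ᵇ_ : ∀ {n} → Fin n → Subset n → Bool
x ∈ᵇ S = lookup S x

record Graph (n : ℕ) : Set where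
  field
    V      : Subset n
    E      : Fin n → Fin n → Bool
    E-sym  : ∀ u v → E u v ≡ E v u
    E-loop : ∀ v → E v v ≡ false
    E-V    : ∀ u v → E u v ≡ true → (u ∈ V) × (v ∈ V)
open Graph public

record WGraph (n : ℕ) : Set where
  field
    graph : Graph n
    ℓ     : Fin n → Fin n → ℚ
    ℓ-sym : ∀ u v → ℓ u v ≡ ℓ v u
    ℓ-nonneg : ∀ u v → 0ℚ ≤ℚ ℓ u v
open WGraph public

induced-E : ∀ {n} → Graph n → Subset n → Fin n → Fin n → Bool
induced-E G W u v = E G u v ∧ ((u ∈ᵇ W) ∧ (v ∈ᵇ W))

private
  ∧-true-l : ∀ {a b} → (a ∧ b) ≡ true → a ≡ true
  ∧-true-l {true} p = refl
  ∧-true-l {false} ()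

  ∧-true-r : ∀ {a b} → (a ∧ b) ≡ true → b ≡ true
  ∧-true-r {true} p = p
  ∧-true-r {false} ()

  lookup-∈ : ∀ {n} (S : Subset n) (x : Fin n) → lookup S x ≡ true → x ∈ S
  lookup-∈ (true Data.Vec.∷ S) fzero p = here
  lookup-∈ (false Data.Vec.∷ S) fzero ()
  lookup-∈ (b Data.Vec.∷ S) (fsuc x) p = there (lookup-∈ S x p)

_[_] : ∀ {n} → Graph n → Subset n → Graph n
G [ W ] = record
  { V = W
  ; E = induced-E G W
  ; E-sym = λ u v → trans (cong (_∧ ((u ∈ᵇ W) ∧ (v ∈ᵇ W))) (E-sym G u v))
                          (cong (E G v u ∧_) (∧-comm (u ∈ᵇ W) (v ∈ᵇ W)))
  ; E-loop = λ v → cong (_∧ ((v ∈ᵇ W) ∧ (v ∈ᵇ W))) (E-loop G v)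
  ; E-V = λ u v p → lookup-∈ W u (∧-true-l (∧-true-r {E G u v} p))
                  , lookup-∈ W v (∧-true-r (∧-true-r {E G u v} p))
  }

_[_]ʷ : ∀ {n} → WGraph n → Subset n → WGraph n
G [ W ]ʷ = record { graph = graph G [ W ] ; ℓ = ℓ G ; ℓ-sym = ℓ-sym G ; ℓ-nonneg = ℓ-nonneg G }

-- Multi-sets of edges: lists of vertex pairs, a pair (u , v) standing
-- for the edge {u , v}; the multiplicity of an edge is its number of
-- occurrences.

EdgeMultiset : ℕ → Set
EdgeMultiset n = List (Fin n × Fin n)

_⊆E_ : ∀ {n} → EdgeMultiset n → Graph n → Set
F ⊆E H = All (λ e → E H (proj₁ e) (proj₂ e) ≡ true) F

_⟪_⟫ : ∀ {n} → EdgeMultiset n → Subset n → EdgeMultiset n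
F ⟪ W ⟫ = filter (λ e → (proj₁ e ∈ᵇ W) ∧ (proj₂ e ∈ᵇ W) Data.Bool.≟ true) F

deg : ∀ {n} → EdgeMultiset n → Fin n → ℕ
deg [] v = 0
deg ((a , b) ∷ F) v = (if ⌊ a ≟ v ⌋ then 1 else 0) + (if ⌊ b ≟ v ⌋ then 1 else 0) + deg F v

isOdd : ℕ → Bool
isOdd zero = false
isOdd (suc k) = not (isOdd k)

odd : ∀ {n} → EdgeMultiset n → Subset n
odd F = tabulate (λ v → isOdd (deg F v))

Adjacent : ∀ {n} → EdgeMultiset n → Fin n → Fin n → Set
Adjacent F x y = ((x , y) ∈ₗ F) ⊎ ((y , x) ∈ₗ F)

data Reach {n} (F : EdgeMultiset n) : Fin n → Fin n → Set where
  stop : ∀ {x} → Reach F x x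
  step : ∀ {x y z} → Adjacent F x y → Reach F y z → Reach F x z

-- Reachability in the multigraph F after contracting the set I to a single
-- vertex: paths may additionally pass between any two vertices of I.
data ReachContr {n} (I : Subset n) (F : EdgeMultiset n) : Fin n → Fin n → Set where
  stop : ∀ {x} → ReachContr I F x x
  step : ∀ {x y z} → Adjacent F x y → ReachContr I F y z → ReachContr I F x z
  jump : ∀ {x y z} → x ∈ I → y ∈ I → ReachContr I F y z → ReachContr I F x z

ConnectedContr : ∀ {n} → Subset n → EdgeMultiset n → Subset n → Set
ConnectedContr U F I = ∀ u v → u ∈ U → v ∈ U → ReachContr I F u v

IsComponent : ∀ {n} → Subset n → EdgeMultiset n → Subset n → Set
IsComponent U F K =
  K ⊆ U × Σ _ (λ x → x ∈ K × (∀ y → (y ∈ K → (y ∈ U × Reach F x y))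
                                    × ((y ∈ U × Reach F x y) → y ∈ K)))

Family : ℕ → Set₁
Family n = Subset n → Set

record Interface (n : ℕ) : Set₁ where
  constructor ⟨_,_,_⟩
  field
    I : Subset n
    T : Subset n
    𝒞 : Family n
open Interface public

IsPartition : ∀ {n} → Family n → Subset n → Set
IsPartition 𝒞 I =
  (∀ S → 𝒞 S → Nonempty S × S ⊆ I)
  × (∀ S S' → 𝒞 S → 𝒞 S' → S ≡ S' ⊎ Empty (S ∩ S'))
  × (∀ x → x ∈ I → Σ _ (λ S → 𝒞 S × x ∈ S))

IsInterface : ∀ {n} → Graph n → Interface n → Set
IsInterface H Φ =
  T Φ ⊆ I Φ × I Φ ⊆ V H × 2 ∣ ∣ T Φ ∣ × IsPartition (𝒞 Φ) (I Φ)

IsTour : ∀ {n} → Graph n → Interface n → EdgeMultiset n → Set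
IsTour H Φ F =
  F ⊆E H
  × odd F ≡ T Φ
  × ConnectedContr (V H) F (I Φ)
  × (∀ C → 𝒞 Φ C → Σ _ (λ K → IsComponent (V H) F K × C ⊆ K))

boundary : ∀ {n} → Graph n → EdgeMultiset n → Subset n → Subset n
boundary G F W = tabulate λ w → (w ∈ᵇ W) ∧ any (λ e → crosses w (proj₁ e) (proj₂ e)) F
  where
    out : _ → Bool
    out x = (x ∈ᵇ V G) ∧ not (x ∈ᵇ W)
    crosses : _ → _ → _ → Bool
    crosses w a b = (⌊ a ≟ w ⌋ ∧ out b) ∨ (⌊ b ≟ w ⌋ ∧ out a)

inducedInterface : ∀ {n} → Graph n → Interface n → EdgeMultiset n → Subset n → Interface n
inducedInterface G Φ F W = ⟨ IW , odd (F ⟪ W ⟫) , 𝒞W ⟩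
  where
    IW = (I Φ ∩ W) ∪ boundary G F W
    𝒞W : Family _
    𝒞W S = Nonempty S × Σ _ (λ K → IsComponent W (F ⟪ W ⟫) K × S ≡ K ∩ IW)

_≈ᵢ_ : ∀ {n} → Interface n → Interface n → Set
Φ ≈ᵢ Ψ = I Φ ≡ I Ψ × T Φ ≡ T Ψ × (∀ S → (𝒞 Φ S → 𝒞 Ψ S) × (𝒞 Ψ S → 𝒞 Φ S))

module Submission where

-- A vertex of W that is not on the boundary has the same degree in F⟪W⟫ as in F,
-- so the odd vertices of F⟪W⟫ lie in (T ∩ W) ∪ boundary ⊆ I_W; their number is even by the
-- handshake lemma. The classes of 𝒞_W are the traces on I_W of the components of F⟪W⟫, hence
-- partition I_W. An I-contracted F-path between vertices of W can only leave W through
-- boundary vertices, which lie in I_W, so F⟪W⟫ is connected once I_W is contracted. Finally,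
-- restricting to W and then to W' ⊆ W gives F⟪W'⟫ and the same interface vertices, because
-- an F-edge leaving W' either stays inside W or also leaves W.

open import Algebra.Bundles using (CommutativeRing)
open import Data.Bool using (Bool; true; false; _∧_; _∨_; not; _xor_; if_then_else_)
  renaming (T to IsTrue)
open import Data.Bool.ListAction using (any)
open import Data.Bool.Properties
  using (T-≡; T-not-≡; T-∧; T-∨; ¬-not; not-distribˡ-xor; not-involutive; xor-∧-commutativeRing)
  renaming (_≟_ to _≟ᵇ_)
open import Data.Empty using (⊥-elim)
open import Data.Fin using (Fin; zero; suc)
open import Data.Fin.Properties using (_≟_)
open import Data.Fin.Subset using (Subset; _∈_; _∉_; _⊆_; _∩_; _∪_; ∣_∣; Nonempty; Empty)
open import Data.Fin.Subset.Properties
  using (_∈?_; ⊆-antisym; x∈p∩q⁺; x∈p∩q⁻; x∈p∪q⁺; x∈p∪q⁻)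
open import Data.List using ([]; _∷_)
open import Data.List.Membership.Propositional using (find; lose) renaming (_∈_ to _∈ₗ_)
open import Data.List.Membership.Propositional.Properties using (∈-filter⁺; ∈-filter⁻)
open import Data.List.Properties using (filter-accept; filter-reject)
import Data.List.Relation.Unary.All as All
open import Data.List.Relation.Unary.Any using (Any; here; there)
open import Data.List.Relation.Unary.Any.Properties using (any⁺; any⁻)
open import Data.Nat using (ℕ; zero; suc; _+_)
open import Data.Nat.Divisibility using (_∣_; divides; ∣-refl; ∣m∣n⇒∣m+n)
open import Data.Product using (Σ; ∃; _×_; _,_; proj₁; proj₂)
open import Data.Sum using (_⊎_; inj₁; inj₂)
open import Data.Vec using (tabulate; lookup)
open import Data.Vec.Properties using ([]=⇒lookup; lookup⇒[]=; lookup∘tabulate)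
open import Function using (_∘_; Equivalence)
open import Relation.Nullary using (Dec; yes; no; ⌊_⌋)
open import Relation.Nullary.Decidable
  using (isYes≗does; dec-false; ⌊⌋-map′; map′; _×-dec_; _⊎-dec_; toWitness; fromWitness)
open import Relation.Binary.PropositionalEquality
  using (_≡_; _≢_; refl; sym; trans; cong; cong₂; subst; module ≡-Reasoning)

open import Defs

open Equivalence using (to; from)

private
  variable
    n : ℕ
    a b v x y z : Fin n
    C J K K' S U W W' : Subset n
    F : EdgeMultiset n

∈⇒T : x ∈ S → IsTrue (x ∈ᵇ S)
∈⇒T x∈S = from T-≡ ([]=⇒lookup x∈S)

T⇒∈ : IsTrue (x ∈ᵇ S) → x ∈ S
T⇒∈ {x = x} {S = S} t = lookup⇒[]= x S (to T-≡ t)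

∉⇒T-not : x ∉ S → IsTrue (not (x ∈ᵇ S))
∉⇒T-not x∉S = from T-not-≡ (¬-not (x∉S ∘ T⇒∈ ∘ from T-≡))

T-not⇒∉ : IsTrue (not (x ∈ᵇ S)) → x ∉ S
T-not⇒∉ t x∈S = subst (IsTrue ∘ not) ([]=⇒lookup x∈S) t

∈-tabulate⁻ : {f : Fin n → Bool} → x ∈ tabulate f → IsTrue (f x)
∈-tabulate⁻ {x = x} {f = f} x∈ = subst IsTrue (lookup∘tabulate f x) (∈⇒T x∈)

∈-tabulate⁺ : {f : Fin n → Bool} → IsTrue (f x) → x ∈ tabulate f
∈-tabulate⁺ {x = x} {f = f} t = T⇒∈ (subst IsTrue (sym (lookup∘tabulate f x)) t)

-- Parity and the handshake lemma

parity : (Fin n → Bool) → Bool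
parity {zero}  f = false
parity {suc n} f = f zero xor parity (f ∘ suc)

parity-cong : {f g : Fin n → Bool} → (∀ x → f x ≡ g x) → parity f ≡ parity g
parity-cong {zero}  f≗g = refl
parity-cong {suc n} f≗g = cong₂ _xor_ (f≗g zero) (parity-cong (f≗g ∘ suc))

parity-xor : (f g : Fin n → Bool) → parity (λ x → f x xor g x) ≡ parity f xor parity g
parity-xor {zero}  f g = refl
parity-xor {suc n} f g = trans
  (cong ((f zero xor g zero) xor_) (parity-xor (f ∘ suc) (g ∘ suc)))
  (interchange (f zero) (g zero) (parity (f ∘ suc)) (parity (g ∘ suc)))
  where open import Algebra.Properties.CommutativeSemigroup
          (CommutativeRing.+-commutativeSemigroup xor-∧-commutativeRing) using (interchange)

parity-false : parity {n} (λ _ → false) ≡ false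
parity-false {zero}  = refl
parity-false {suc n} = parity-false {n}

parity-indicator : (a : Fin n) → parity (λ x → ⌊ a ≟ x ⌋) ≡ true
parity-indicator {suc n} zero    = cong (true xor_) (parity-false {n})
parity-indicator {suc n} (suc a) = trans (parity-cong (λ x → ⌊⌋-map′ _ _ (a ≟ x))) (parity-indicator a)

isOdd-+ : ∀ m k → isOdd (m + k) ≡ isOdd m xor isOdd k
isOdd-+ zero    k = refl
isOdd-+ (suc m) k = trans (cong not (isOdd-+ m k)) (not-distribˡ-xor (isOdd m) (isOdd k))

isOdd-indicator : ∀ b → isOdd (if b then 1 else 0) ≡ b
isOdd-indicator false = refl
isOdd-indicator true  = refl

isOdd-∣tabulate∣ : (f : Fin n → Bool) → isOdd ∣ tabulate f ∣ ≡ parity f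
isOdd-∣tabulate∣ {zero}  f = refl
isOdd-∣tabulate∣ {suc n} f with f zero
... | true  = cong not (isOdd-∣tabulate∣ (f ∘ suc))
... | false = isOdd-∣tabulate∣ (f ∘ suc)

isOdd-deg-∷ : ∀ (a b : Fin n) F x →
  isOdd (deg ((a , b) ∷ F) x) ≡ (⌊ a ≟ x ⌋ xor ⌊ b ≟ x ⌋) xor isOdd (deg F x)
isOdd-deg-∷ a b F x = begin
  isOdd ((if ⌊ a ≟ x ⌋ then 1 else 0) + (if ⌊ b ≟ x ⌋ then 1 else 0) + deg F x)
    ≡⟨ isOdd-+ ((if ⌊ a ≟ x ⌋ then 1 else 0) + (if ⌊ b ≟ x ⌋ then 1 else 0)) (deg F x) ⟩
  isOdd ((if ⌊ a ≟ x ⌋ then 1 else 0) + (if ⌊ b ≟ x ⌋ then 1 else 0)) xor isOdd (deg F x)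
    ≡⟨ cong (_xor isOdd (deg F x)) (isOdd-+ (if ⌊ a ≟ x ⌋ then 1 else 0) _) ⟩
  (isOdd (if ⌊ a ≟ x ⌋ then 1 else 0) xor isOdd (if ⌊ b ≟ x ⌋ then 1 else 0)) xor isOdd (deg F x)
    ≡⟨ cong (_xor isOdd (deg F x)) (cong₂ _xor_ (isOdd-indicator ⌊ a ≟ x ⌋) (isOdd-indicator ⌊ b ≟ x ⌋)) ⟩
  (⌊ a ≟ x ⌋ xor ⌊ b ≟ x ⌋) xor isOdd (deg F x)
    ∎
  where open ≡-Reasoning

parity-odd-degrees : (F : EdgeMultiset n) → parity (λ x → isOdd (deg F x)) ≡ false
parity-odd-degrees {n} [] = parity-false {n}
parity-odd-degrees ((a , b) ∷ F) = begin
  parity (λ x → isOdd (deg ((a , b) ∷ F) x))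
    ≡⟨ parity-cong (isOdd-deg-∷ a b F) ⟩
  parity (λ x → (⌊ a ≟ x ⌋ xor ⌊ b ≟ x ⌋) xor isOdd (deg F x))
    ≡⟨ parity-xor (λ x → ⌊ a ≟ x ⌋ xor ⌊ b ≟ x ⌋) (λ x → isOdd (deg F x)) ⟩
  parity (λ x → ⌊ a ≟ x ⌋ xor ⌊ b ≟ x ⌋) xor parity (λ x → isOdd (deg F x))
    ≡⟨ cong₂ _xor_ (parity-xor (λ x → ⌊ a ≟ x ⌋) (λ x → ⌊ b ≟ x ⌋)) (parity-odd-degrees F) ⟩
  (parity (λ x → ⌊ a ≟ x ⌋) xor parity (λ x → ⌊ b ≟ x ⌋)) xor false
    ≡⟨ cong (λ p → p xor false) (cong₂ _xor_ (parity-indicator a) (parity-indicator b)) ⟩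
  false
    ∎
  where open ≡-Reasoning

isOdd≡false⇒2∣ : ∀ m → isOdd m ≡ false → 2 ∣ m
isOdd≡false⇒2∣ zero          _    = divides 0 refl
isOdd≡false⇒2∣ (suc (suc m)) even =
  ∣m∣n⇒∣m+n {m = 2} ∣-refl (isOdd≡false⇒2∣ m (trans (sym (not-involutive (isOdd m))) even))

handshake : (F : EdgeMultiset n) → 2 ∣ ∣ odd F ∣
handshake F = isOdd≡false⇒2∣ _
  (trans (isOdd-∣tabulate∣ (λ x → isOdd (deg F x))) (parity-odd-degrees F))

-- Reachability and connected components

Adjacent-sym : Adjacent F x y → Adjacent F y x
Adjacent-sym (inj₁ xy∈F) = inj₂ xy∈F
Adjacent-sym (inj₂ yx∈F) = inj₁ yx∈F

Reach-trans : Reach F x y → Reach F y z → Reach F x z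
Reach-trans stop         q = q
Reach-trans (step adj p) q = step adj (Reach-trans p q)

Reach-sym : Reach F x y → Reach F y x
Reach-sym stop         = stop
Reach-sym (step adj p) = Reach-trans (Reach-sym p) (step (Adjacent-sym adj) stop)

Adjacent-∷ : ∀ {e} → Adjacent F x y → Adjacent (e ∷ F) x y
Adjacent-∷ (inj₁ p) = inj₁ (there p)
Adjacent-∷ (inj₂ p) = inj₂ (there p)

Reach-∷ : ∀ {e} → Reach F x y → Reach (e ∷ F) x y
Reach-∷ stop         = stop
Reach-∷ (step adj p) = step (Adjacent-∷ adj) (Reach-∷ p)

Reach-[] : Reach {n} [] x y → x ≡ y
Reach-[] stop                = refl
Reach-[] (step (inj₁ ()) _)
Reach-[] (step (inj₂ ()) _)

ReachThrough : EdgeMultiset n → Fin n → Fin n → Fin n → Fin n → Set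
ReachThrough F a b x y = Reach F x y ⊎ (Reach F x a × Reach F b y) ⊎ (Reach F x b × Reach F a y)

ReachThrough-step : Adjacent F x y → ReachThrough F a b y z → ReachThrough F a b x z
ReachThrough-step adj (inj₁ q)              = inj₁ (step adj q)
ReachThrough-step adj (inj₂ (inj₁ (q , r))) = inj₂ (inj₁ (step adj q , r))
ReachThrough-step adj (inj₂ (inj₂ (q , r))) = inj₂ (inj₂ (step adj q , r))

-- A path either avoids the new edge {a , b} or can be cut at its last use of it.
Reach-∷⁻ : Reach ((a , b) ∷ F) x y → ReachThrough F a b x y
Reach-∷⁻ stop = inj₁ stop
Reach-∷⁻ (step (inj₁ (here refl)) p) with Reach-∷⁻ p
... | inj₁ q              = inj₂ (inj₁ (stop , q))
... | inj₂ (inj₁ (_ , q)) = inj₂ (inj₁ (stop , q))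
... | inj₂ (inj₂ (_ , q)) = inj₁ q
Reach-∷⁻ (step (inj₂ (here refl)) p) with Reach-∷⁻ p
... | inj₁ q              = inj₂ (inj₂ (stop , q))
... | inj₂ (inj₁ (_ , q)) = inj₁ q
... | inj₂ (inj₂ (_ , q)) = inj₂ (inj₂ (stop , q))
Reach-∷⁻ (step (inj₁ (there e)) p) = ReachThrough-step (inj₁ e) (Reach-∷⁻ p)
Reach-∷⁻ (step (inj₂ (there e)) p) = ReachThrough-step (inj₂ e) (Reach-∷⁻ p)

Reach-∷⁺ : ReachThrough F a b x y → Reach ((a , b) ∷ F) x y
Reach-∷⁺ (inj₁ p) = Reach-∷ p
Reach-∷⁺ (inj₂ (inj₁ (p , q))) =
  Reach-trans (Reach-∷ p) (step (inj₁ (here refl)) (Reach-∷ q))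
Reach-∷⁺ (inj₂ (inj₂ (p , q))) =
  Reach-trans (Reach-∷ p) (step (inj₂ (here refl)) (Reach-∷ q))

Reach? : (F : EdgeMultiset n) (x y : Fin n) → Dec (Reach F x y)
Reach? [] x y with x ≟ y
... | yes refl = yes stop
... | no  x≢y  = no (x≢y ∘ Reach-[])
Reach? ((a , b) ∷ F) x y = map′ Reach-∷⁺ Reach-∷⁻
  (Reach? F x y ⊎-dec ((Reach? F x a ×-dec Reach? F b y) ⊎-dec (Reach? F x b ×-dec Reach? F a y)))

componentOf : (U : Subset n) (F : EdgeMultiset n) → x ∈ U → Σ (Subset n) λ K → IsComponent U F K × x ∈ K
componentOf {x = x} U F x∈U = component , (component⊆U , x , x∈component , λ y → ∈component⁻ , ∈component⁺) , x∈component
  where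
  component : Subset _
  component = tabulate (λ y → (y ∈ᵇ U) ∧ ⌊ Reach? F x y ⌋)
  ∈component⁻ : y ∈ component → y ∈ U × Reach F x y
  ∈component⁻ y∈component with to T-∧ (∈-tabulate⁻ y∈component)
  ... | y∈ᵇU , reach = T⇒∈ y∈ᵇU , toWitness reach
  ∈component⁺ : y ∈ U × Reach F x y → y ∈ component
  ∈component⁺ (y∈U , reach) = ∈-tabulate⁺ (from T-∧ (∈⇒T y∈U , fromWitness reach))
  component⊆U : component ⊆ U
  component⊆U = proj₁ ∘ ∈component⁻
  x∈component : x ∈ component
  x∈component = ∈component⁺ (x∈U , stop)

IsComponent-≡⊎disjoint : IsComponent U F K → IsComponent U F K' → K ≡ K' ⊎ Empty (K ∩ K')
IsComponent-≡⊎disjoint {F = F} {K = K} {K' = K'} (_ , r , _ , K⇔) (_ , r' , _ , K'⇔) with Reach? F r r'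
... | yes r⇝r' = inj₁ (⊆-antisym
  (λ y∈K → let y∈U , r⇝y = proj₁ (K⇔ _) y∈K in proj₂ (K'⇔ _) (y∈U , Reach-trans (Reach-sym r⇝r') r⇝y))
  (λ y∈K' → let y∈U , r'⇝y = proj₁ (K'⇔ _) y∈K' in proj₂ (K⇔ _) (y∈U , Reach-trans r⇝r' r'⇝y)))
... | no ¬r⇝r' = inj₂ λ (y , y∈K∩K') →
  let y∈K , y∈K' = x∈p∩q⁻ K K' y∈K∩K'
  in ¬r⇝r' (Reach-trans (proj₂ (proj₁ (K⇔ y) y∈K)) (Reach-sym (proj₂ (proj₁ (K'⇔ y) y∈K'))))

-- The interface partition 𝒞_W of the paper, with U = W and J = I_W.
ComponentTraces : Subset n → EdgeMultiset n → Subset n → Family n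
ComponentTraces U F J S = Nonempty S × Σ (Subset _) λ K → IsComponent U F K × S ≡ K ∩ J

ComponentTraces-inComponent : ComponentTraces U F J C → Σ (Subset n) λ K → IsComponent U F K × C ⊆ K
ComponentTraces-inComponent {J = J} (_ , K , K-comp , refl) = K , K-comp , proj₁ ∘ x∈p∩q⁻ K J

ComponentTraces-isPartition : J ⊆ U → IsPartition (ComponentTraces U F J) J
ComponentTraces-isPartition {J = J} {U = U} {F = F} J⊆U = nonempty-inside , equal-or-disjoint , covering
  where
  nonempty-inside : ∀ S → ComponentTraces U F J S → Nonempty S × S ⊆ J
  nonempty-inside _ (S≠∅ , K , _ , refl) = S≠∅ , proj₂ ∘ x∈p∩q⁻ K J
  equal-or-disjoint : ∀ S S' → ComponentTraces U F J S → ComponentTraces U F J S' → S ≡ S' ⊎ Empty (S ∩ S')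
  equal-or-disjoint _ _ (_ , K , K-comp , refl) (_ , K' , K'-comp , refl)
    with IsComponent-≡⊎disjoint K-comp K'-comp
  ... | inj₁ refl     = inj₁ refl
  ... | inj₂ K∩K'≡∅ = inj₂ λ (y , y∈S∩S') →
    let y∈K∩J , y∈K'∩J = x∈p∩q⁻ (K ∩ J) (K' ∩ J) y∈S∩S'
    in K∩K'≡∅ (y , x∈p∩q⁺ (proj₁ (x∈p∩q⁻ K J y∈K∩J) , proj₁ (x∈p∩q⁻ K' J y∈K'∩J)))
  covering : ∀ x → x ∈ J → Σ (Subset _) λ S → ComponentTraces U F J S × x ∈ S
  covering x x∈J with componentOf U F (J⊆U x∈J)
  ... | K , K-comp , x∈K = K ∩ J , ((x , x∈K∩J) , K , K-comp , refl) , x∈K∩J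
    where x∈K∩J = x∈p∩q⁺ (x∈K , x∈J)

-- Restriction to a vertex set

BothIn : Subset n → Fin n × Fin n → Set
BothIn W (a , b) = (a ∈ᵇ W) ∧ (b ∈ᵇ W) ≡ true

bothIn? : (W : Subset n) (e : Fin n × Fin n) → Dec (BothIn W e)
bothIn? W (a , b) = (a ∈ᵇ W) ∧ (b ∈ᵇ W) ≟ᵇ true

BothIn⁺ : a ∈ W → b ∈ W → BothIn W (a , b)
BothIn⁺ a∈W b∈W = cong₂ _∧_ ([]=⇒lookup a∈W) ([]=⇒lookup b∈W)

BothIn⁻ : BothIn W (a , b) → a ∈ W × b ∈ W
BothIn⁻ both with to T-∧ (from T-≡ both)
... | a∈ᵇW , b∈ᵇW = T⇒∈ a∈ᵇW , T⇒∈ b∈ᵇW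

Adjacent-⟪⟫⁺ : Adjacent F x y → x ∈ W → y ∈ W → Adjacent (F ⟪ W ⟫) x y
Adjacent-⟪⟫⁺ {W = W} (inj₁ xy∈F) x∈W y∈W = inj₁ (∈-filter⁺ (bothIn? W) xy∈F (BothIn⁺ x∈W y∈W))
Adjacent-⟪⟫⁺ {W = W} (inj₂ yx∈F) x∈W y∈W = inj₂ (∈-filter⁺ (bothIn? W) yx∈F (BothIn⁺ y∈W x∈W))

Adjacent-⟪⟫⁻ : Adjacent (F ⟪ W ⟫) x y → Adjacent F x y × y ∈ W
Adjacent-⟪⟫⁻ {W = W} (inj₁ xy∈F⟪W⟫) with ∈-filter⁻ (bothIn? W) xy∈F⟪W⟫
... | xy∈F , both = inj₁ xy∈F , proj₂ (BothIn⁻ both)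
Adjacent-⟪⟫⁻ {W = W} (inj₂ yx∈F⟪W⟫) with ∈-filter⁻ (bothIn? W) yx∈F⟪W⟫
... | yx∈F , both = inj₂ yx∈F , proj₁ (BothIn⁻ both)

⟪⟫-⊆E : (G : Graph n) → F ⊆E G → (F ⟪ W ⟫) ⊆E (G [ W ])
⟪⟫-⊆E {W = W} G F⊆G = All.tabulate λ {e} e∈F⟪W⟫ →
  let e∈F , both = ∈-filter⁻ (bothIn? W) e∈F⟪W⟫
  in trans (cong (_∧ _) (All.lookup F⊆G e∈F)) both

⟪⟫-⟪⟫ : W' ⊆ W → (F : EdgeMultiset n) → F ⟪ W ⟫ ⟪ W' ⟫ ≡ F ⟪ W' ⟫
⟪⟫-⟪⟫ W'⊆W [] = refl
⟪⟫-⟪⟫ {W' = W'} {W = W} W'⊆W (e ∷ F) = by-cases (bothIn? W' e) (bothIn? W e)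
  where
  open ≡-Reasoning
  within : BothIn W' e → BothIn W e
  within both = let a∈W' , b∈W' = BothIn⁻ both in BothIn⁺ (W'⊆W a∈W') (W'⊆W b∈W')
  by-cases : Dec (BothIn W' e) → Dec (BothIn W e) → (e ∷ F) ⟪ W ⟫ ⟪ W' ⟫ ≡ (e ∷ F) ⟪ W' ⟫
  by-cases (yes in-W') _ = begin
    (e ∷ F) ⟪ W ⟫ ⟪ W' ⟫ ≡⟨ cong (_⟪ W' ⟫) (filter-accept (bothIn? W) (within in-W')) ⟩
    (e ∷ F ⟪ W ⟫) ⟪ W' ⟫ ≡⟨ filter-accept (bothIn? W') in-W' ⟩
    e ∷ F ⟪ W ⟫ ⟪ W' ⟫   ≡⟨ cong (e ∷_) (⟪⟫-⟪⟫ W'⊆W F) ⟩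
    e ∷ F ⟪ W' ⟫         ≡⟨ filter-accept (bothIn? W') in-W' ⟨
    (e ∷ F) ⟪ W' ⟫       ∎
  by-cases (no ¬in-W') (yes in-W) = begin
    (e ∷ F) ⟪ W ⟫ ⟪ W' ⟫ ≡⟨ cong (_⟪ W' ⟫) (filter-accept (bothIn? W) in-W) ⟩
    (e ∷ F ⟪ W ⟫) ⟪ W' ⟫ ≡⟨ filter-reject (bothIn? W') ¬in-W' ⟩
    F ⟪ W ⟫ ⟪ W' ⟫       ≡⟨ ⟪⟫-⟪⟫ W'⊆W F ⟩
    F ⟪ W' ⟫             ≡⟨ filter-reject (bothIn? W') ¬in-W' ⟨
    (e ∷ F) ⟪ W' ⟫       ∎
  by-cases (no ¬in-W') (no ¬in-W) = begin
    (e ∷ F) ⟪ W ⟫ ⟪ W' ⟫ ≡⟨ cong (_⟪ W' ⟫) (filter-reject (bothIn? W) ¬in-W) ⟩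
    F ⟪ W ⟫ ⟪ W' ⟫       ≡⟨ ⟪⟫-⟪⟫ W'⊆W F ⟩
    F ⟪ W' ⟫             ≡⟨ filter-reject (bothIn? W') ¬in-W' ⟨
    (e ∷ F) ⟪ W' ⟫       ∎

Outside : Graph n → Subset n → Fin n → Set
Outside G W y = y ∈ V G × y ∉ W

isOutside : Graph n → Subset n → Fin n → Bool
isOutside G W y = (y ∈ᵇ V G) ∧ not (y ∈ᵇ W)

-- The Boolean test used inside Defs.boundary, which is local to that definition.
crossesOut : Graph n → Subset n → Fin n → Fin n × Fin n → Bool
crossesOut G W x e = (⌊ proj₁ e ≟ x ⌋ ∧ isOutside G W (proj₂ e)) ∨ (⌊ proj₂ e ≟ x ⌋ ∧ isOutside G W (proj₁ e))

outside⁺ : (G : Graph n) → Outside G W y → IsTrue (isOutside G W y)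
outside⁺ G (y∈V , y∉W) = from T-∧ (∈⇒T y∈V , ∉⇒T-not y∉W)

outside⁻ : (G : Graph n) → IsTrue (isOutside G W y) → Outside G W y
outside⁻ G out with to T-∧ out
... | y∈ᵇV , y∉ᵇW = T⇒∈ y∈ᵇV , T-not⇒∉ y∉ᵇW

crossesOut⁺ : (G : Graph n) → (a ≡ x × Outside G W b) ⊎ (b ≡ x × Outside G W a)
            → IsTrue (crossesOut G W x (a , b))
crossesOut⁺ {a = a} {x = x} {W = W} {b = b} G (inj₁ (refl , b-out)) =
  from (T-∨ {⌊ a ≟ x ⌋ ∧ isOutside G W b}) (inj₁ (from T-∧ (fromWitness {a? = a ≟ a} refl , outside⁺ G b-out)))
crossesOut⁺ {a = a} {x = x} {W = W} {b = b} G (inj₂ (refl , a-out)) =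
  from (T-∨ {⌊ a ≟ x ⌋ ∧ isOutside G W b}) (inj₂ (from T-∧ (fromWitness {a? = b ≟ b} refl , outside⁺ G a-out)))

crossesOut⁻ : (G : Graph n) → IsTrue (crossesOut G W x (a , b))
            → (a ≡ x × Outside G W b) ⊎ (b ≡ x × Outside G W a)
crossesOut⁻ {W = W} {x = x} {a = a} {b = b} G crossing with to (T-∨ {⌊ a ≟ x ⌋ ∧ isOutside G W b}) crossing
... | inj₁ a≡x∧out = let a≡x , b-out = to (T-∧ {⌊ a ≟ x ⌋}) a≡x∧out in inj₁ (toWitness a≡x , outside⁻ G b-out)
... | inj₂ b≡x∧out = let b≡x , a-out = to (T-∧ {⌊ b ≟ x ⌋}) b≡x∧out in inj₂ (toWitness b≡x , outside⁻ G a-out)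

boundary⁺ : (G : Graph n) (F : EdgeMultiset n) → x ∈ W → Adjacent F x y → Outside G W y → x ∈ boundary G F W
boundary⁺ {x = x} {W = W} {y = y} G F x∈W adj y-out =
  ∈-tabulate⁺ (from T-∧ (∈⇒T x∈W , any⁺ (crossesOut G W x) (crossing adj)))
  where
  crossing : Adjacent F x y → Any (IsTrue ∘ crossesOut G W x) F
  crossing (inj₁ xy∈F) = lose xy∈F (crossesOut⁺ G (inj₁ (refl , y-out)))
  crossing (inj₂ yx∈F) = lose yx∈F (crossesOut⁺ G (inj₂ (refl , y-out)))

boundary⁻ : (G : Graph n) (F : EdgeMultiset n) → x ∈ boundary G F W → x ∈ W × ∃ λ y → Adjacent F x y × Outside G W y
boundary⁻ {x = x} {W = W} G F x∈bd with to (T-∧ {x ∈ᵇ W}) (∈-tabulate⁻ x∈bd)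
... | x∈ᵇW , crosses with find (any⁻ (crossesOut G W x) F crosses)
...   | (a , b) , ab∈F , crossing with crossesOut⁻ {W = W} {x = x} {a = a} {b = b} G crossing
...     | inj₁ (refl , b-out) = T⇒∈ x∈ᵇW , b , inj₁ ab∈F , b-out
...     | inj₂ (refl , a-out) = T⇒∈ x∈ᵇW , a , inj₂ ab∈F , a-out

deg-∷-≢ : (F : EdgeMultiset n) → a ≢ x → b ≢ x → deg ((a , b) ∷ F) x ≡ deg F x
deg-∷-≢ {a = a} {x = x} {b = b} F a≢x b≢x =
  cong₂ (λ i j → (if i then 1 else 0) + (if j then 1 else 0) + deg F x)
        (⌊≟⌋≡false a≢x) (⌊≟⌋≡false b≢x)
  where
  ⌊≟⌋≡false : ∀ {u} → u ≢ x → ⌊ u ≟ x ⌋ ≡ false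
  ⌊≟⌋≡false {u} u≢x = trans (isYes≗does (u ≟ x)) (dec-false (u ≟ x) u≢x)

deg-⟪⟫-outside : x ∉ W → (F : EdgeMultiset n) → deg (F ⟪ W ⟫) x ≡ 0
deg-⟪⟫-outside x∉W [] = refl
deg-⟪⟫-outside {x = x} {W = W} x∉W ((a , b) ∷ F) with bothIn? W (a , b)
... | yes both = let a∈W , b∈W = BothIn⁻ {W = W} both in
  trans (deg-∷-≢ {a = a} {b = b} (F ⟪ W ⟫) (λ { refl → x∉W a∈W }) (λ { refl → x∉W b∈W })) (deg-⟪⟫-outside x∉W F)
... | no _ = deg-⟪⟫-outside x∉W F

deg-⟪⟫-inside : x ∈ W → (F : EdgeMultiset n) → (∀ {y} → Adjacent F x y → y ∈ W) → deg (F ⟪ W ⟫) x ≡ deg F x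
deg-⟪⟫-inside x∈W [] _ = refl
deg-⟪⟫-inside {x = x} {W = W} x∈W ((a , b) ∷ F) nbrs∈W with bothIn? W (a , b)
... | yes _ = cong (λ d → (if ⌊ a ≟ x ⌋ then 1 else 0) + (if ⌊ b ≟ x ⌋ then 1 else 0) + d)
                   (deg-⟪⟫-inside x∈W F (nbrs∈W ∘ Adjacent-∷))
... | no ¬both = trans (deg-⟪⟫-inside x∈W F (nbrs∈W ∘ Adjacent-∷)) (sym (deg-∷-≢ F a≢x b≢x))
  where
  a≢x : a ≢ x
  a≢x refl = ¬both (BothIn⁺ x∈W (nbrs∈W (inj₁ (here refl))))
  b≢x : b ≢ x
  b≢x refl = ¬both (BothIn⁺ (nbrs∈W (inj₂ (here refl))) x∈W)

-- The induced interface

inducedVertices : Graph n → Subset n → EdgeMultiset n → Subset n → Subset n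
inducedVertices G J F W = (J ∩ W) ∪ boundary G F W

inducedVertices⁺ˡ : (G : Graph n) (F : EdgeMultiset n) → x ∈ J → x ∈ W → x ∈ inducedVertices G J F W
inducedVertices⁺ˡ G F x∈J x∈W = x∈p∪q⁺ (inj₁ (x∈p∩q⁺ (x∈J , x∈W)))

inducedVertices⁺ʳ : (G : Graph n) (F : EdgeMultiset n) → x ∈ boundary G F W → x ∈ inducedVertices G J F W
inducedVertices⁺ʳ G F x∈bd = x∈p∪q⁺ (inj₂ x∈bd)

inducedVertices⊆ : (G : Graph n) → inducedVertices G J F W ⊆ W
inducedVertices⊆ {J = J} {F = F} {W = W} G x∈Jᵂ with x∈p∪q⁻ (J ∩ W) (boundary G F W) x∈Jᵂ
... | inj₁ x∈J∩W = proj₂ (x∈p∩q⁻ J W x∈J∩W)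
... | inj₂ x∈bd  = proj₁ (boundary⁻ G F x∈bd)

Adjacent⇒∈V : (G : Graph n) → F ⊆E G → Adjacent F x y → y ∈ V G
Adjacent⇒∈V G F⊆G (inj₁ xy∈F) = proj₂ (E-V G _ _ (All.lookup F⊆G xy∈F))
Adjacent⇒∈V G F⊆G (inj₂ yx∈F) = proj₁ (E-V G _ _ (All.lookup F⊆G yx∈F))

-- A vertex of W that is odd in F⟪W⟫ but not on the boundary keeps all its F-edges inside W.
odd-⟪⟫⊆ : (G : Graph n) → F ⊆E G → odd (F ⟪ W ⟫) ⊆ (odd F ∩ W) ∪ boundary G F W
odd-⟪⟫⊆ {F = F} {W = W} G F⊆G {x} x∈odd with x ∈? W | x ∈? boundary G F W
... | no x∉W | _ = ⊥-elim (subst (IsTrue ∘ isOdd) (deg-⟪⟫-outside x∉W F) (∈-tabulate⁻ x∈odd))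
... | yes _ | yes x∈bd = x∈p∪q⁺ (inj₂ x∈bd)
... | yes x∈W | no x∉bd = x∈p∪q⁺ (inj₁ (x∈p∩q⁺ (∈-tabulate⁺ odd-in-F , x∈W)))
  where
  nbrs∈W : Adjacent F x y → y ∈ W
  nbrs∈W {y} adj with y ∈? W
  ... | yes y∈W = y∈W
  ... | no y∉W  = ⊥-elim (x∉bd (boundary⁺ G F x∈W adj (Adjacent⇒∈V G F⊆G adj , y∉W)))
  odd-in-F : IsTrue (isOdd (deg F x))
  odd-in-F = subst (IsTrue ∘ isOdd) (deg-⟪⟫-inside x∈W F nbrs∈W) (∈-tabulate⁻ x∈odd)

odd-⟪⟫⊆inducedVertices : (G : Graph n) → F ⊆E G → odd F ⊆ J → odd (F ⟪ W ⟫) ⊆ inducedVertices G J F W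
odd-⟪⟫⊆inducedVertices {F = F} {W = W} G F⊆G oddF⊆J x∈odd
  with x∈p∪q⁻ (odd F ∩ W) (boundary G F W) (odd-⟪⟫⊆ G F⊆G x∈odd)
... | inj₁ x∈oddF∩W = let x∈oddF , x∈W = x∈p∩q⁻ (odd F) W x∈oddF∩W in inducedVertices⁺ˡ G F (oddF⊆J x∈oddF) x∈W
... | inj₂ x∈bd     = inducedVertices⁺ʳ G F x∈bd

-- What survives of a J-contracted F-path from x to v ∈ W: the path itself if x ∈ W, and
-- otherwise its tail from the first vertex where it enters W, which lies in I_W.
RestrictedReach : Graph n → Subset n → EdgeMultiset n → Subset n → Fin n → Fin n → Set
RestrictedReach G J F W x v =
  (x ∈ W → ReachContr (inducedVertices G J F W) (F ⟪ W ⟫) x v)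
  × (x ∉ W → ∃ λ z → z ∈ inducedVertices G J F W × ReachContr (inducedVertices G J F W) (F ⟪ W ⟫) z v)

ReachContr-restrict : (G : Graph n) → F ⊆E G → v ∈ W → ReachContr J F x v → RestrictedReach G J F W x v
ReachContr-restrict G F⊆G v∈W stop = (λ _ → stop) , (λ v∉W → ⊥-elim (v∉W v∈W))
ReachContr-restrict {F = F} {W = W} G F⊆G v∈W (step {y = y} adj p) with ReachContr-restrict G F⊆G v∈W p | y ∈? W
... | inside , _ | yes y∈W =
  (λ x∈W → step (Adjacent-⟪⟫⁺ adj x∈W y∈W) (inside y∈W))
  , (λ x∉W → y , inducedVertices⁺ʳ G F (boundary⁺ G F y∈W (Adjacent-sym adj)
                                        (Adjacent⇒∈V G F⊆G (Adjacent-sym adj) , x∉W))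
               , inside y∈W)
... | _ , outside | no y∉W =
  (λ x∈W → let z , z∈Jᵂ , q = outside y∉W in
           jump (inducedVertices⁺ʳ G F (boundary⁺ G F x∈W adj (Adjacent⇒∈V G F⊆G adj , y∉W))) z∈Jᵂ q)
  , (λ _ → outside y∉W)
ReachContr-restrict {F = F} {W = W} G F⊆G v∈W (jump {y = y} x∈J y∈J p) with ReachContr-restrict G F⊆G v∈W p | y ∈? W
... | inside , _ | yes y∈W =
  (λ x∈W → jump (inducedVertices⁺ˡ G F x∈J x∈W) (inducedVertices⁺ˡ G F y∈J y∈W) (inside y∈W))
  , (λ _ → y , inducedVertices⁺ˡ G F y∈J y∈W , inside y∈W)
... | _ , outside | no y∉W =
  (λ x∈W → let z , z∈Jᵂ , q = outside y∉W in jump (inducedVertices⁺ˡ G F x∈J x∈W) z∈Jᵂ q)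
  , (λ _ → outside y∉W)

ConnectedContr-⟪⟫ : (G : Graph n) → F ⊆E G → W ⊆ V G → ConnectedContr (V G) F J
                  → ConnectedContr W (F ⟪ W ⟫) (inducedVertices G J F W)
ConnectedContr-⟪⟫ G F⊆G W⊆V connected u v u∈W v∈W =
  proj₁ (ReachContr-restrict G F⊆G v∈W (connected u v (W⊆V u∈W) (W⊆V v∈W))) u∈W

inducedVertices-nest : (G : Graph n) (F : EdgeMultiset n) → W' ⊆ W → W ⊆ V G →
  inducedVertices (G [ W ]) (inducedVertices G J F W) (F ⟪ W ⟫) W' ≡ inducedVertices G J F W'
inducedVertices-nest {W' = W'} {W = W} {J = J} G F W'⊆W W⊆V = ⊆-antisym nested⊆direct direct⊆nested
  where
  Jᵂ = inducedVertices G J F W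
  nested⊆direct : inducedVertices (G [ W ]) Jᵂ (F ⟪ W ⟫) W' ⊆ inducedVertices G J F W'
  nested⊆direct x∈ with x∈p∪q⁻ (Jᵂ ∩ W') (boundary (G [ W ]) (F ⟪ W ⟫) W') x∈
  ... | inj₂ x∈bd[W] =
    let x∈W' , y , adj , y∈W , y∉W' = boundary⁻ {W = W'} (G [ W ]) (F ⟪ W ⟫) x∈bd[W]
    in inducedVertices⁺ʳ G F (boundary⁺ G F x∈W' (proj₁ (Adjacent-⟪⟫⁻ {W = W} adj)) (W⊆V y∈W , y∉W'))
  ... | inj₁ x∈Jᵂ∩W' with x∈p∩q⁻ Jᵂ W' x∈Jᵂ∩W'
  ...   | x∈Jᵂ , x∈W' with x∈p∪q⁻ (J ∩ W) (boundary G F W) x∈Jᵂ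
  ...     | inj₁ x∈J∩W = inducedVertices⁺ˡ G F (proj₁ (x∈p∩q⁻ J W x∈J∩W)) x∈W'
  ...     | inj₂ x∈bd =
    let _ , y , adj , y∈V , y∉W = boundary⁻ G F x∈bd
    in inducedVertices⁺ʳ G F (boundary⁺ G F x∈W' adj (y∈V , y∉W ∘ W'⊆W))
  direct⊆nested : inducedVertices G J F W' ⊆ inducedVertices (G [ W ]) Jᵂ (F ⟪ W ⟫) W'
  direct⊆nested x∈ with x∈p∪q⁻ (J ∩ W') (boundary G F W') x∈
  ... | inj₁ x∈J∩W' =
    let x∈J , x∈W' = x∈p∩q⁻ J W' x∈J∩W'
    in inducedVertices⁺ˡ (G [ W ]) (F ⟪ W ⟫) (inducedVertices⁺ˡ G F x∈J (W'⊆W x∈W')) x∈W'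
  ... | inj₂ x∈bd with boundary⁻ G F x∈bd
  ...   | x∈W' , y , adj , y∈V , y∉W' with y ∈? W
  ...     | yes y∈W = inducedVertices⁺ʳ (G [ W ]) (F ⟪ W ⟫)
                        (boundary⁺ (G [ W ]) (F ⟪ W ⟫) x∈W' (Adjacent-⟪⟫⁺ adj (W'⊆W x∈W') y∈W) (y∈W , y∉W'))
  ...     | no y∉W  = inducedVertices⁺ˡ (G [ W ]) (F ⟪ W ⟫)
                        (inducedVertices⁺ʳ G F (boundary⁺ G F (W'⊆W x∈W') adj (y∈V , y∉W))) x∈W'

inducedInterface-nest : (G : Graph n) (Φ : Interface n) (F : EdgeMultiset n) → W' ⊆ W → W ⊆ V G →
  inducedInterface (G [ W ]) (inducedInterface G Φ F W) (F ⟪ W ⟫) W' ≡ inducedInterface G Φ F W'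
inducedInterface-nest {W' = W'} G Φ F W'⊆W W⊆V =
  cong₂ (λ F' J → ⟨ J , odd F' , ComponentTraces W' F' J ⟩)
        (⟪⟫-⟪⟫ W'⊆W F) (inducedVertices-nest G F W'⊆W W⊆V)

≡⇒≈ᵢ : {Φ Ψ : Interface n} → Φ ≡ Ψ → Φ ≈ᵢ Ψ
≡⇒≈ᵢ refl = refl , refl , λ _ → (λ C → C) , (λ C → C)

lemma5p6 : {n : ℕ} (G : WGraph n) (Φ : Interface n) (F : EdgeMultiset n) (W : Subset n)
    → IsInterface (graph G) Φ
    → IsTour (graph G) Φ F
    → W ⊆ V (graph G)
    → IsInterface (graph (G [ W ]ʷ)) (inducedInterface (graph G) Φ F W)
      × IsTour (graph (G [ W ]ʷ)) (inducedInterface (graph G) Φ F W) (F ⟪ W ⟫)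
      × ((W' : Subset n) → W' ⊆ W
         → inducedInterface (graph (G [ W ]ʷ)) (inducedInterface (graph G) Φ F W) (F ⟪ W ⟫) W'
           ≈ᵢ inducedInterface (graph G) Φ F W')
lemma5p6 G Φ F W (T⊆I , _ , _ , _) (F⊆G , oddF≡T , connected , _) W⊆V =
  ( odd-⟪⟫⊆inducedVertices {W = W} (graph G) F⊆G (T⊆I ∘ subst (_ ∈_) oddF≡T)
  , inducedVertices⊆ {F = F} {W = W} (graph G)
  , handshake (F ⟪ W ⟫)
  , ComponentTraces-isPartition (inducedVertices⊆ {F = F} {W = W} (graph G)) )
  , ( ⟪⟫-⊆E {W = W} (graph G) F⊆G
    , refl
    , ConnectedContr-⟪⟫ (graph G) F⊆G W⊆V connected
    , λ _ → ComponentTraces-inComponent )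
  , λ W' W'⊆W → ≡⇒≈ᵢ (inducedInterface-nest (graph G) Φ F W'⊆W W⊆V)
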